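{- Let $f(x,y)=\sum_{i,j}\lambda(i,j)x^iy^j$ and $g(x,y)=\sum_{i,j}c(i,j)x^iy^j$ be two nonzero formal bilateral series with complex coefficients, and suppose $g$ is antisymmetric, i.e. $g(x,y)=-g(y,x)$ (equivalently $c(i,j)=-c(j,i)$ for all $i,j$). If $f\perp g$, then $g\perp g$.
   Context: A formal bilateral series in $x,y$ is an expression $\sum_{i,j\in\mathbb{Z}}\lambda(i,j)x^iy^j$ with arbitrary complex coefficients. For two such series $f,g$, we say $f$ is orthogonal to $g$, written $f\perp g$, if $$g(a,b)f(x,c)-g(a,c)f(x,b)+g(b,c)f(x,a)=0$$ identically in the four independent variables $a,b,c,x$ (each product is a product of series in disjoint sets of variables, hence a well-defined formal series). Equivalently, $f\perp g$ iff $c(m,i)\lambda(k,j)-c(m,j)\lambda(k,i)+c(i,j)\lambda(k,m)=0$ for all integers $m,i,j,k$. -}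

module Defs where

open import Level using (Level; suc; _⊔_)
open import Data.Nat using (ℕ)
open import Data.Integer using (ℤ)
open import Data.Product using (∃₂)
open import Relation.Nullary using (¬_)
open import Algebra.Bundles using (CommutativeRing; Semiring)
import Algebra.Definitions.RawSemiring as RS
open import Relation.Binary.PropositionalEquality using () renaming (_≡_ to _≡ℕ_)

-- A field of characteristic zero (stand-in for ℂ, which agda-stdlib lacks).
record CharZeroField (c ℓ : Level) : Set (suc (c ⊔ ℓ)) where
  field
    commutativeRing : CommutativeRing c ℓ
  open CommutativeRing commutativeRing public
  open RS (Semiring.rawSemiring semiring) using (_×_) public
  field
    1≉0      : ¬ (1# ≈ 0#)
    inv      : (x : Carrier) → ¬ (x ≈ 0#) → Carrier
    inv-law  : (x : Carrier) (p : ¬ (x ≈ 0#)) → x * inv x p ≈ 1#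
    charZero : (n : ℕ) → n × 1# ≈ 0# → n ≡ℕ 0

module _ {c ℓ} (K : CharZeroField c ℓ) where
  open CharZeroField K

  BilateralSeries : Set c
  BilateralSeries = ℤ → ℤ → Carrier

  NonZeroSeries : BilateralSeries → Set ℓ
  NonZeroSeries f = ∃₂ λ i j → ¬ (f i j ≈ 0#)

  Antisymmetric : BilateralSeries → Set ℓ
  Antisymmetric g = ∀ i j → g i j ≈ - g j i

  Orthogonal : BilateralSeries → BilateralSeries → Set ℓ
  Orthogonal f g = ∀ m i j k →
    (g m i * f k j) - (g m j * f k i) + (g i j * f k m) ≈ 0#

{-# OPTIONS --safe #-}
module Submission where

-- Pick a nonzero coefficient P = f(k,p). Specialising f ⊥ g to the indices (a, b, p, k) gives
-- P g(a,b) = u(a) v(b) - u(b) v(a) with u = g(·,p) and v = f(k,·), so P g is the decomposable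
-- bivector u ∧ v. The relation g ⊥ g is quadratic in g, and for u ∧ v it is the Plücker relation,
-- a polynomial identity; cancelling P² gives g ⊥ g.

open import Defs
open import Algebra.Bundles using (CommutativeRing)
import Algebra.Properties.CommutativeSemigroup as CommutativeSemigroupProperties
import Algebra.Properties.Ring as RingProperties
import Algebra.Properties.Semiring.Mult as SemiringMultProperties
open import Algebra.Solver.Ring.AlmostCommutativeRing
  using (_-Raw-AlmostCommutative⟶_; fromCommutativeRing)
import Algebra.Solver.Ring as RingSolver
open import Data.Integer as ℤ using (ℤ; +_; -[1+_]; +[1+_])
import Data.Integer.Properties as ℤ
open import Data.Maybe as Maybe using (Maybe)
open import Data.Nat as ℕ using (suc)
import Data.Nat.Properties as ℕ
open import Data.Product using (_,_)
open import Function using (_∘_)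
open import Relation.Binary.Consequences using (dec⇒weaklyDec)
open import Relation.Binary.PropositionalEquality as ≡ using (_≡_)
import Relation.Binary.Reasoning.Setoid as SetoidReasoning
open import Relation.Nullary using (¬_)

-- The ring solver needs a coefficient ring with decidable equality (so that e.g. 1 - 1 is
-- recognised as 0) together with a homomorphism into R; ℤ, mapped in as n ↦ n · 1, serves.
module IntegerCoefficientSolver {c ℓ} (R : CommutativeRing c ℓ) where
  open CommutativeRing R
  open RingProperties ring using (-0#≈0#; -‿involutive; -‿+-comm; -‿distribˡ-*; -‿distribʳ-*)
  open CommutativeSemigroupProperties +-commutativeSemigroup using (interchange)
  open SemiringMultProperties semiring using (_×_; ×-homo-+; ×1-homo-*)
  open SetoidReasoning setoid

  fromℤ : ℤ → Carrier
  fromℤ (+ n)    = n × 1#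
  fromℤ -[1+ n ] = - (suc n × 1#)

  fromℤ-cong : ∀ {i j} → i ≡ j → fromℤ i ≈ fromℤ j
  fromℤ-cong = reflexive ∘ ≡.cong fromℤ

  x-y≈[1+x]-[1+y] : ∀ x y → x - y ≈ (1# + x) - (1# + y)
  x-y≈[1+x]-[1+y] x y = begin
    x - y                     ≈⟨ +-identityˡ (x - y) ⟨
    0# + (x - y)              ≈⟨ +-congʳ (-‿inverseʳ 1#) ⟨
    (1# - 1#) + (x - y)       ≈⟨ interchange 1# (- 1#) x (- y) ⟩
    (1# + x) + (- 1# + - y)   ≈⟨ +-congˡ (-‿+-comm 1# y) ⟩
    (1# + x) - (1# + y)       ∎

  fromℤ-homo-⊖ : ∀ m n → fromℤ (m ℤ.⊖ n) ≈ m × 1# - n × 1#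
  fromℤ-homo-⊖ m       0       = sym (trans (+-congˡ -0#≈0#) (+-identityʳ _))
  fromℤ-homo-⊖ 0       (suc n) = sym (+-identityˡ _)
  fromℤ-homo-⊖ (suc m) (suc n) = begin
    fromℤ (suc m ℤ.⊖ suc n)  ≈⟨ fromℤ-cong (ℤ.[1+m]⊖[1+n]≡m⊖n m n) ⟩
    fromℤ (m ℤ.⊖ n)          ≈⟨ fromℤ-homo-⊖ m n ⟩
    m × 1# - n × 1#          ≈⟨ x-y≈[1+x]-[1+y] (m × 1#) (n × 1#) ⟩
    suc m × 1# - suc n × 1#  ∎

  fromℤ-homo-- : ∀ i → fromℤ (ℤ.- i) ≈ - fromℤ i
  fromℤ-homo-- -[1+ n ] = sym (-‿involutive _)
  fromℤ-homo-- (+ 0)    = sym -0#≈0#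
  fromℤ-homo-- +[1+ n ] = refl

  fromℤ-homo-+ : ∀ i j → fromℤ (i ℤ.+ j) ≈ fromℤ i + fromℤ j
  fromℤ-homo-+ -[1+ m ] -[1+ n ] = begin
    - (suc (suc (m ℕ.+ n)) × 1#)      ≈⟨ -‿cong (reflexive (≡.cong (λ k → suc k × 1#) (ℕ.+-suc m n))) ⟨
    - ((suc m ℕ.+ suc n) × 1#)        ≈⟨ -‿cong (×-homo-+ 1# (suc m) (suc n)) ⟩
    - (suc m × 1# + suc n × 1#)       ≈⟨ -‿+-comm _ _ ⟨
    - (suc m × 1#) + - (suc n × 1#)   ∎
  fromℤ-homo-+ -[1+ m ] (+ n)    = trans (fromℤ-homo-⊖ n (suc m)) (+-comm _ _)
  fromℤ-homo-+ (+ m)    -[1+ n ] = fromℤ-homo-⊖ m (suc n)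
  fromℤ-homo-+ (+ m)    (+ n)    = ×-homo-+ 1# m n

  fromℤ-homo-*ˡ-+ : ∀ m j → fromℤ (+ m ℤ.* j) ≈ fromℤ (+ m) * fromℤ j
  fromℤ-homo-*ˡ-+ m (+ n)    = trans (fromℤ-cong (≡.sym (ℤ.pos-* m n))) (×1-homo-* m n)
  fromℤ-homo-*ˡ-+ m -[1+ n ] = begin
    fromℤ (+ m ℤ.* -[1+ n ])         ≈⟨ fromℤ-cong (ℤ.neg-distribʳ-* (+ m) +[1+ n ]) ⟨
    fromℤ (ℤ.- (+ m ℤ.* +[1+ n ]))   ≈⟨ fromℤ-homo-- (+ m ℤ.* +[1+ n ]) ⟩
    - fromℤ (+ m ℤ.* +[1+ n ])       ≈⟨ -‿cong (fromℤ-homo-*ˡ-+ m +[1+ n ]) ⟩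
    - (fromℤ (+ m) * fromℤ +[1+ n ]) ≈⟨ -‿distribʳ-* _ _ ⟩
    fromℤ (+ m) * fromℤ -[1+ n ]     ∎

  fromℤ-homo-* : ∀ i j → fromℤ (i ℤ.* j) ≈ fromℤ i * fromℤ j
  fromℤ-homo-* (+ m)    j = fromℤ-homo-*ˡ-+ m j
  fromℤ-homo-* -[1+ m ] j = begin
    fromℤ (-[1+ m ] ℤ.* j)         ≈⟨ fromℤ-cong (ℤ.neg-distribˡ-* +[1+ m ] j) ⟨
    fromℤ (ℤ.- (+[1+ m ] ℤ.* j))   ≈⟨ fromℤ-homo-- (+[1+ m ] ℤ.* j) ⟩
    - fromℤ (+[1+ m ] ℤ.* j)       ≈⟨ -‿cong (fromℤ-homo-*ˡ-+ (suc m) j) ⟩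
    - (fromℤ +[1+ m ] * fromℤ j)   ≈⟨ -‿distribˡ-* _ _ ⟩
    fromℤ -[1+ m ] * fromℤ j       ∎

  fromℤ-homomorphism : ℤ.+-*-rawRing -Raw-AlmostCommutative⟶ fromCommutativeRing R
  fromℤ-homomorphism = record
    { ⟦_⟧    = fromℤ
    ; +-homo = fromℤ-homo-+
    ; *-homo = fromℤ-homo-*
    ; -‿homo = fromℤ-homo--
    ; 0-homo = refl
    ; 1-homo = +-identityʳ 1#
    }

  fromℤ-≟ : ∀ i j → Maybe (fromℤ i ≈ fromℤ j)
  fromℤ-≟ i j = Maybe.map fromℤ-cong (dec⇒weaklyDec ℤ._≟_ i j)

  open RingSolver ℤ.+-*-rawRing (fromCommutativeRing R) fromℤ-homomorphism fromℤ-≟ public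

module Orthogonality {c ℓ i} (R : CommutativeRing c ℓ) {I : Set i} where
  open CommutativeRing R
  open IntegerCoefficientSolver R
  open SetoidReasoning setoid

  orthogonality : (f g : I → I → Carrier) → I → I → I → I → Carrier
  orthogonality f g m i j k = g m i * f k j - g m j * f k i + g i j * f k m

  _∧_ : (I → Carrier) → (I → Carrier) → I → I → Carrier
  (u ∧ v) a b = u a * v b - u b * v a

  orthogonality-∧-self : ∀ u v m i j k → orthogonality (u ∧ v) (u ∧ v) m i j k ≈ 0#
  orthogonality-∧-self u v m i j k = solve 8
    (λ um ui uj uk vm vi vj vk →
      (um :* vi :- ui :* vm) :* (uk :* vj :- uj :* vk)
        :- (um :* vj :- uj :* vm) :* (uk :* vi :- ui :* vk)
        :+ (ui :* vj :- uj :* vi) :* (uk :* vm :- um :* vk)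
      := con (+ 0))
    refl (u m) (u i) (u j) (u k) (v m) (v i) (v j) (v k)

  orthogonality-*-self : ∀ g x m i j k →
    orthogonality (λ a b → g a b * x) (λ a b → g a b * x) m i j k ≈ orthogonality g g m i j k * x * x
  orthogonality-*-self g x m i j k = solve 7
    (λ mi kj mj ki ij km x →
      (mi :* x) :* (kj :* x) :- (mj :* x) :* (ki :* x) :+ (ij :* x) :* (km :* x)
      := (mi :* kj :- mj :* ki :+ ij :* km) :* x :* x)
    refl (g m i) (g k j) (g m j) (g k i) (g i j) (g k m) x

  orthogonality-cong-self : ∀ {g h} → (∀ a b → g a b ≈ h a b) →
    ∀ m i j k → orthogonality g g m i j k ≈ orthogonality h h m i j k
  orthogonality-cong-self g≈h m i j k =
    +-cong (+-cong (*-cong (g≈h m i) (g≈h k j)) (-‿cong (*-cong (g≈h m j) (g≈h k i))))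
           (*-cong (g≈h i j) (g≈h k m))

  x-y+z≈0⇒x≈y-z : ∀ x y z → x - y + z ≈ 0# → x ≈ y - z
  x-y+z≈0⇒x≈y-z x y z x-y+z≈0 = begin
    x                      ≈⟨ solve 3 (λ x y z → x := (x :- y :+ z) :+ (y :- z)) refl x y z ⟩
    (x - y + z) + (y - z)  ≈⟨ +-congʳ x-y+z≈0 ⟩
    0# + (y - z)           ≈⟨ +-identityˡ (y - z) ⟩
    y - z                  ∎

  orthogonal⇒*-≈-∧ : ∀ {f g} → (∀ m i j k → orthogonality f g m i j k ≈ 0#) →
    ∀ k p a b → g a b * f k p ≈ ((λ a → g a p) ∧ f k) a b
  orthogonal⇒*-≈-∧ {f} {g} f⊥g k p a b =
    x-y+z≈0⇒x≈y-z (g a b * f k p) (g a p * f k b) (g b p * f k a) (f⊥g a b p k)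

module _ {c ℓ} (K : CharZeroField c ℓ) where
  open CharZeroField K
  open SetoidReasoning setoid

  x*y≈0⇒x≈0 : ∀ {x y} → ¬ (y ≈ 0#) → x * y ≈ 0# → x ≈ 0#
  x*y≈0⇒x≈0 {x} {y} y≉0 xy≈0 = begin
    x                   ≈⟨ *-identityʳ x ⟨
    x * 1#              ≈⟨ *-congˡ (inv-law y y≉0) ⟨
    x * (y * inv y y≉0) ≈⟨ *-assoc x y _ ⟨
    (x * y) * inv y y≉0 ≈⟨ *-congʳ xy≈0 ⟩
    0# * inv y y≉0      ≈⟨ zeroˡ _ ⟩
    0#                  ∎

lemma2p4 : ∀ {c ℓ} (K : CharZeroField c ℓ) (f g : BilateralSeries K) →
             NonZeroSeries K f → NonZeroSeries K g → Antisymmetric K g →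
             Orthogonal K f g → Orthogonal K g g
lemma2p4 K f g (k , p , P≉0) _ _ f⊥g m i j l =
  x*y≈0⇒x≈0 K P≉0 (x*y≈0⇒x≈0 K P≉0 (begin
    orthogonality g g m i j l * P * P          ≈⟨ orthogonality-*-self g P m i j l ⟨
    orthogonality gP gP m i j l                ≈⟨ orthogonality-cong-self (orthogonal⇒*-≈-∧ f⊥g k p) m i j l ⟩
    orthogonality (u ∧ f k) (u ∧ f k) m i j l  ≈⟨ orthogonality-∧-self u (f k) m i j l ⟩
    0#                                         ∎))
  where
  open CharZeroField K
  open Orthogonality commutativeRing
  open SetoidReasoning setoid
  P : Carrier
  P = f k p
  u : ℤ → Carrier
  u a = g a p
  gP : BilateralSeries K
  gP a b = g a b * P
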